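{- Let $n=2k+1$ be odd and let $P$ be an $n\times n$ normalized weak Hadamard matrix whose columns are pairwise orthogonal. Then every column of $P$ other than the all-ones column $\mathbf{1}$ has at least three entries equal to $0$.
   Context: A weak Hadamard matrix is a real $n\times n$ matrix $P$ with all entries in $\{ -1,0,1\}$ such that $P^TP$ is tridiagonal. It is normalized if its first row and its first column consist entirely of $1$'s. -}

module Defs where

open import Data.Nat using (ℕ; suc)
open import Data.Fin using (Fin; toℕ)
open import Data.Integer using (ℤ; +_; -[1+_]; _+_; _*_)
open import Data.Sum using (_⊎_)
open import Data.Product using (_×_)
open import Relation.Binary.PropositionalEquality using (_≡_)
open import Relation.Nullary using (¬_)

-- real n×n matrices with entries in {-1,0,1}; we use integer entries
Matrix : ℕ → Set
Matrix n = Fin n → Fin n → ℤ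

Σ : ∀ {n} → (Fin n → ℤ) → ℤ
Σ {ℕ.zero} f = + 0
Σ {suc n} f = f Fin.zero + Σ (λ i → f (Fin.suc i))

-- (P^T P) i j = Σ_r P r i * P r j  (inner product of columns i and j)
colDot : ∀ {n} → Matrix n → Fin n → Fin n → ℤ
colDot P i j = Σ (λ r → P r i * P r j)

Trit : ℤ → Set
Trit x = (x ≡ -[1+ 0 ]) ⊎ (x ≡ + 0) ⊎ (x ≡ + 1)

FarApart : ℕ → ℕ → Set
FarApart a b = (suc (suc a) Data.Nat.≤ b) ⊎ (suc (suc b) Data.Nat.≤ a)

IsTridiagonal : ∀ {n} → Matrix n → Set
IsTridiagonal {n} M = ∀ (i j : Fin n) → FarApart (toℕ i) (toℕ j) → M i j ≡ + 0

IsWeakHadamard : ∀ {n} → Matrix n → Set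
IsWeakHadamard {n} P =
  (∀ (r c : Fin n) → Trit (P r c)) × IsTridiagonal (colDot P)

IsNormalized : ∀ {n} → Matrix (suc n) → Set
IsNormalized {n} P =
  (∀ (c : Fin (suc n)) → P Fin.zero c ≡ + 1) × (∀ (r : Fin (suc n)) → P r Fin.zero ≡ + 1)

ColumnsOrthogonal : ∀ {n} → Matrix n → Set
ColumnsOrthogonal {n} P = ∀ (i j : Fin n) → ¬ (i ≡ j) → colDot P i j ≡ + 0

{-# OPTIONS --safe #-}
module Submission where

-- A column c ≠ 0 is orthogonal to the all-ones column, so its entries sum to 0.
-- On {-1, 0, 1} the number x + [x = 0] is always odd, hence the number of zeros
-- of column c has the parity of n and is odd: this excludes zero and two zeros.
-- If z were the only zero, then for every column j ∉ {0, c} the sum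
-- ∑ᵣ P r j (1 + P r c) = 0 has all terms even except P z j, so row z is
-- (1, 0, …, 0).  Deleting it leaves n pairwise orthogonal nonzero vectors in
-- ℤⁿ⁻¹, which is impossible because any n vectors in ℤⁿ⁻¹ are linearly dependent.

open import Defs

-- Scoped, so that the integer operations do not clash with the ℕ-multiplication
-- in the statement of lemma2p5.
module _ where
  open import Data.Nat as ℕ using (zero; suc; z≤n; s≤s)
  open import Data.Fin using (Fin; zero; suc; punchIn; punchOut)
  open import Data.Fin.Properties using (any?; punchInᵢ≢i; punchIn-injective; punchIn-punchOut) renaming (_≟_ to _≟ᶠ_)
  open import Data.Integer using (ℤ; +_; +[1+_]; -[1+_]; 0ℤ; 1ℤ; -1ℤ; _+_; _*_; -_; _-_; _≤_; _<_; +≤+; +<+)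
  open import Data.Integer.Properties
  open import Data.Integer.Divisibility.Signed using (_∣_; divides; ∣⇒∣ᵤ; ∣m⇒∣-m; ∣m∣n⇒∣m+n; ∣m+n∣n⇒∣m)
  open import Data.Integer.Tactic.RingSolver using (solve-∀)
  open import Data.Nat.Divisibility using (∣1⇒≡1)
  open import Data.Vec.Functional using (Vector; insertAt; removeAt)
  open import Data.Vec.Functional.Properties using (insertAt-lookup; insertAt-punchIn)
  open import Algebra.Properties.Semiring.Sum +-*-semiring
    using (sum; sum-cong-≗; sum-replicate-zero; sum-remove; ∑-distrib-+; ∑-comm; *-distribˡ-sum)
  open import Data.Product using (∃; _×_; _,_)
  open import Data.Sum using (inj₁; inj₂; [_,_]′)
  open import Data.Empty using (⊥-elim)
  open import Function using (_∘_; id)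
  open import Relation.Binary.PropositionalEquality
  open import Relation.Nullary using (¬_; yes; no; ¬?)
  open import Relation.Nullary.Decidable using (decidable-stable)

  Σ≡sum : ∀ {n} (f : Vector ℤ n) → Σ f ≡ sum f
  Σ≡sum {zero} f = refl
  Σ≡sum {suc n} f = cong (λ s → f zero + s) (Σ≡sum (f ∘ suc))

  sum-zero : ∀ {n} {f : Vector ℤ n} → (∀ i → f i ≡ 0ℤ) → sum f ≡ 0ℤ
  sum-zero {n} f≗0 = trans (sum-cong-≗ f≗0) (sum-replicate-zero n)

  sum-single : ∀ {n} {f : Vector ℤ (suc n)} p → (∀ i → i ≢ p → f i ≡ 0ℤ) → sum f ≡ f p
  sum-single {f = f} p f≗0 = begin
    sum f                       ≡⟨ sum-remove f ⟩
    f p + sum (removeAt f p)    ≡⟨ cong (λ s → f p + s) (sum-zero (λ i → f≗0 _ (punchInᵢ≢i p i))) ⟩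
    f p + 0ℤ                    ≡⟨ +-identityʳ (f p) ⟩
    f p                         ∎
    where open ≡-Reasoning

  sum-pair : ∀ {n} {f : Vector ℤ n} {p q} → p ≢ q → (∀ i → i ≢ p → i ≢ q → f i ≡ 0ℤ) → sum f ≡ f p + f q
  sum-pair {suc zero} {p = zero} {zero} p≢q _ = ⊥-elim (p≢q refl)
  sum-pair {suc (suc n)} {f} {p} {q} p≢q f≗0 = begin
    sum f                                   ≡⟨ sum-remove f ⟩
    f p + sum (removeAt f p)                ≡⟨ cong (λ s → f p + s) (sum-single q′ rest≗0) ⟩
    f p + f (punchIn p q′)                  ≡⟨ cong (λ r → f p + f r) (punchIn-punchOut p≢q) ⟩
    f p + f q                               ∎
    where
    open ≡-Reasoning
    q′ : Fin (suc n)
    q′ = punchOut p≢q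
    rest≗0 : ∀ i → i ≢ q′ → f (punchIn p i) ≡ 0ℤ
    rest≗0 i i≢q′ = f≗0 _ (punchInᵢ≢i p i) λ pᵢ≡q →
      i≢q′ (punchIn-injective p i q′ (trans pᵢ≡q (sym (punchIn-punchOut p≢q))))

  sum-nonneg : ∀ {n} {f : Vector ℤ n} → (∀ i → 0ℤ ≤ f i) → 0ℤ ≤ sum f
  sum-nonneg {zero} _ = +≤+ z≤n
  sum-nonneg {suc n} f≥0 = +-mono-≤ (f≥0 zero) (sum-nonneg (f≥0 ∘ suc))

  square-nonneg : ∀ x → 0ℤ ≤ x * x
  square-nonneg (+ zero) = +≤+ z≤n
  square-nonneg +[1+ n ] = +≤+ z≤n
  square-nonneg -[1+ n ] = +≤+ z≤n

  square-pos : ∀ {x} → x ≢ 0ℤ → 0ℤ < x * x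
  square-pos {+ zero} x≢0 = ⊥-elim (x≢0 refl)
  square-pos {+[1+ n ]} _ = +<+ (s≤s z≤n)
  square-pos { -[1+ n ]} _ = +<+ (s≤s z≤n)

  infix 7 _·_
  _·_ : ∀ {m} → Vector ℤ m → Vector ℤ m → ℤ
  u · w = sum (λ r → u r * w r)

  u·u≢0 : ∀ {m} (u : Vector ℤ m) s → u s ≢ 0ℤ → u · u ≢ 0ℤ
  u·u≢0 {suc m} u s us≢0 = ≢-sym (<⇒≢ (begin-strict
    0ℤ                                            <⟨ +-mono-<-≤ (square-pos us≢0) (sum-nonneg (square-nonneg ∘ u′)) ⟩
    u s * u s + u′ · u′                           ≡⟨ sum-remove (λ r → u r * u r) ⟨
    u · u                                         ∎))
    where
    open ≤-Reasoning
    u′ : Vector ℤ m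
    u′ = removeAt u s

  linearCombination : ∀ {m n} → Vector ℤ n → (Fin n → Vector ℤ m) → Vector ℤ m
  linearCombination a v r = sum (λ i → a i * v i r)

  LinearlyDependent : ∀ {m n} → (Fin n → Vector ℤ m) → Set
  LinearlyDependent v = ∃ λ a → (∃ λ i → a i ≢ 0ℤ) × (∀ r → linearCombination a v r ≡ 0ℤ)

  zero-heads-dependent : ∀ {m n} (v : Fin (suc n) → Vector ℤ (suc m)) → (∀ i → v i zero ≡ 0ℤ) →
                         LinearlyDependent (λ i r → v (suc i) (suc r)) → LinearlyDependent v
  zero-heads-dependent {n = n} v heads≡0 (a , (i , aᵢ≢0) , a-rel) = a′ , (suc i , aᵢ≢0) , a′-rel
    where
    a′ : Vector ℤ (suc n)
    a′ zero = 0ℤ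
    a′ (suc i) = a i
    a′-rel : ∀ r → linearCombination a′ v r ≡ 0ℤ
    a′-rel zero = sum-zero λ i → trans (cong (a′ i *_) (heads≡0 i)) (*-zeroʳ (a′ i))
    a′-rel (suc r) = trans (+-identityˡ _) (a-rel r)

  clearHead : ∀ {m n} → (Fin (suc n) → Vector ℤ (suc m)) → Fin (suc n) → Fin n → Vector ℤ (suc m)
  clearHead v p j r = v p zero * v (punchIn p j) r - v (punchIn p j) zero * v p r

  clearHead-head : ∀ {m n} (v : Fin (suc n) → Vector ℤ (suc m)) p j → clearHead v p j zero ≡ 0ℤ
  clearHead-head v p j = cancel (v p zero) (v (punchIn p j) zero)
    where
    cancel : ∀ x y → x * y - y * x ≡ 0ℤ
    cancel = solve-∀

  pivot-dependent : ∀ {m n} (v : Fin (suc n) → Vector ℤ (suc m)) p → v p zero ≢ 0ℤ →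
                    LinearlyDependent (λ j r → clearHead v p j (suc r)) → LinearlyDependent v
  pivot-dependent {n = n} v p pivot (μ , (j , μⱼ≢0) , μ-rel) = a , (punchIn p j , aₚⱼ≢0) , a-rel
    where
    b : Vector ℤ n
    b j = v (punchIn p j) zero
    B : ℤ
    B = sum (λ j → μ j * b j)
    -- Expanding ∑ⱼ μⱼ (vₚ₀ vⱼ − vⱼ₀ vₚ) puts vₚ₀ μⱼ on vⱼ and −B on vₚ.
    a : Vector ℤ (suc n)
    a = insertAt (λ j → v p zero * μ j) p (- B)
    aₚⱼ≢0 : a (punchIn p j) ≢ 0ℤ
    aₚⱼ≢0 rewrite insertAt-punchIn (λ j → v p zero * μ j) p (- B) j =
      λ eq → [ pivot , μⱼ≢0 ]′ (i*j≡0⇒i≡0∨j≡0 (v p zero) eq)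
    a≡μ : ∀ r → linearCombination a v r ≡ linearCombination μ (clearHead v p) r
    a≡μ r = begin
      linearCombination a v r
        ≡⟨ sum-remove (λ i → a i * v i r) ⟩
      a p * y + sum (λ j → a (punchIn p j) * w j)
        ≡⟨ cong₂ (λ s t → s * y + t) (insertAt-lookup _ p (- B))
             (sum-cong-≗ (λ j → cong (_* w j) (insertAt-punchIn _ p (- B) j))) ⟩
      - B * y + sum (λ j → v p zero * μ j * w j)
        ≡⟨ swap B y _ ⟩
      sum (λ j → v p zero * μ j * w j) + (- y) * B
        ≡⟨ cong (λ s → sum (λ j → v p zero * μ j * w j) + s) (*-distribˡ-sum (- y) (λ j → μ j * b j)) ⟩
      sum (λ j → v p zero * μ j * w j) + sum (λ j → (- y) * (μ j * b j))
        ≡⟨ ∑-distrib-+ (λ j → v p zero * μ j * w j) _ ⟨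
      sum (λ j → v p zero * μ j * w j + (- y) * (μ j * b j))
        ≡⟨ sum-cong-≗ (λ j → expand (μ j) (v p zero) (w j) (b j) y) ⟩
      linearCombination μ (clearHead v p) r
        ∎
      where
      open ≡-Reasoning
      y : ℤ
      y = v p r
      w : Vector ℤ _
      w j = v (punchIn p j) r
      swap : ∀ b y s → - b * y + s ≡ s + (- y) * b
      swap = solve-∀
      expand : ∀ m x w z y → x * m * w + (- y) * (m * z) ≡ m * (x * w - z * y)
      expand = solve-∀
    a-rel : ∀ r → linearCombination a v r ≡ 0ℤ
    a-rel zero = trans (a≡μ zero) (sum-zero λ j → trans (cong (μ j *_) (clearHead-head v p j)) (*-zeroʳ (μ j)))
    a-rel (suc r) = trans (a≡μ (suc r)) (μ-rel r)

  suc-vectors-dependent : ∀ m (v : Fin (suc m) → Vector ℤ m) → LinearlyDependent v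
  suc-vectors-dependent zero v = (λ _ → 1ℤ) , (zero , λ ()) , λ ()
  suc-vectors-dependent (suc m) v with any? (λ p → ¬? (v p zero ≟ 0ℤ))
  ... | yes (p , pivot) = pivot-dependent v p pivot (suc-vectors-dependent m (λ j r → clearHead v p j (suc r)))
  ... | no no-pivot = zero-heads-dependent v heads≡0 (suc-vectors-dependent m (λ i r → v (suc i) (suc r)))
    where
    heads≡0 : ∀ p → v p zero ≡ 0ℤ
    heads≡0 p = decidable-stable (v p zero ≟ 0ℤ) (λ ne → no-pivot (p , ne))

  ·-linearCombination : ∀ {m n} (u : Vector ℤ m) (a : Vector ℤ n) (v : Fin n → Vector ℤ m) →
                        u · linearCombination a v ≡ sum (λ i → a i * (u · v i))
  ·-linearCombination u a v = begin
    sum (λ r → u r * sum (λ i → a i * v i r))      ≡⟨ sum-cong-≗ (λ r → *-distribˡ-sum (u r) (λ i → a i * v i r)) ⟩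
    sum (λ r → sum (λ i → u r * (a i * v i r)))    ≡⟨ ∑-comm (λ r i → u r * (a i * v i r)) ⟩
    sum (λ i → sum (λ r → u r * (a i * v i r)))    ≡⟨ sum-cong-≗ (λ i → sum-cong-≗ (λ r → shuffle (u r) (a i) (v i r))) ⟩
    sum (λ i → sum (λ r → a i * (u r * v i r)))    ≡⟨ sum-cong-≗ (λ i → *-distribˡ-sum (a i) (λ r → u r * v i r)) ⟨
    sum (λ i → a i * (u · v i))                    ∎
    where
    open ≡-Reasoning
    shuffle : ∀ x a y → x * (a * y) ≡ a * (x * y)
    shuffle = solve-∀

  orthogonal-family-has-null : ∀ m (v : Fin (suc m) → Vector ℤ m) →
                               (∀ i j → i ≢ j → v i · v j ≡ 0ℤ) → ∃ λ i → v i · v i ≡ 0ℤ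
  orthogonal-family-has-null m v orthogonal with suc-vectors-dependent m v
  ... | a , (i , aᵢ≢0) , a-rel = i , [ ⊥-elim ∘ aᵢ≢0 , id ]′ (i*j≡0⇒i≡0∨j≡0 (a i) aᵢvᵢ·vᵢ≡0)
    where
    aᵢvᵢ·vᵢ≡0 : a i * (v i · v i) ≡ 0ℤ
    aᵢvᵢ·vᵢ≡0 = begin
      a i * (v i · v i)                  ≡⟨ sum-single i off-diagonal≡0 ⟨
      sum (λ j → a j * (v i · v j))      ≡⟨ ·-linearCombination (v i) a v ⟨
      v i · linearCombination a v        ≡⟨ sum-zero (λ r → trans (cong (v i r *_) (a-rel r)) (*-zeroʳ (v i r))) ⟩
      0ℤ                                 ∎
      where
      open ≡-Reasoning
      off-diagonal≡0 : ∀ j → j ≢ i → a j * (v i · v j) ≡ 0ℤ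
      off-diagonal≡0 j j≢i = trans (cong (a j *_) (orthogonal i j (≢-sym j≢i))) (*-zeroʳ (a j))

  2∤1 : ¬ + 2 ∣ 1ℤ
  2∤1 2∣1 with ∣1⇒≡1 (∣⇒∣ᵤ 2∣1)
  ... | ()

  trit-even⇒0 : ∀ {x} → Trit x → + 2 ∣ x → x ≡ 0ℤ
  trit-even⇒0 (inj₁ refl) 2∣x = ⊥-elim (2∤1 (∣m⇒∣-m 2∣x))
  trit-even⇒0 (inj₂ (inj₁ x≡0)) _ = x≡0
  trit-even⇒0 (inj₂ (inj₂ refl)) 2∣x = ⊥-elim (2∤1 2∣x)

  ∣-sum : ∀ {d n} {f : Vector ℤ n} → (∀ i → d ∣ f i) → d ∣ sum f
  ∣-sum {n = zero} _ = divides 0ℤ refl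
  ∣-sum {n = suc n} d∣f = ∣m∣n⇒∣m+n (d∣f zero) (∣-sum (d∣f ∘ suc))

  even-y+xy : ∀ {x} y → Trit x → x ≢ 0ℤ → + 2 ∣ y + x * y
  even-y+xy y (inj₁ refl) _ = divides 0ℤ (cancel y)
    where
    cancel : ∀ y → y + -1ℤ * y ≡ 0ℤ * + 2
    cancel = solve-∀
  even-y+xy y (inj₂ (inj₁ x≡0)) x≢0 = ⊥-elim (x≢0 x≡0)
  even-y+xy y (inj₂ (inj₂ refl)) _ = divides y (double y)
    where
    double : ∀ y → y + 1ℤ * y ≡ y * + 2
    double = solve-∀

  -- On {-1, 0, 1} this is the indicator of 0.
  zeroIndicator : ℤ → ℤ
  zeroIndicator x = 1ℤ - x * x

  zeroIndicator-≢0 : ∀ {x} → Trit x → x ≢ 0ℤ → zeroIndicator x ≡ 0ℤ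
  zeroIndicator-≢0 (inj₁ refl) _ = refl
  zeroIndicator-≢0 (inj₂ (inj₁ x≡0)) x≢0 = ⊥-elim (x≢0 x≡0)
  zeroIndicator-≢0 (inj₂ (inj₂ refl)) _ = refl

  trit+zeroIndicator-odd : ∀ {x} → Trit x → + 2 ∣ 1ℤ + (x + zeroIndicator x)
  trit+zeroIndicator-odd (inj₁ refl) = divides 0ℤ refl
  trit+zeroIndicator-odd (inj₂ (inj₁ refl)) = divides 1ℤ refl
  trit+zeroIndicator-odd (inj₂ (inj₂ refl)) = divides 1ℤ refl

  sum-odd : ∀ {n} {f : Vector ℤ n} → (∀ i → + 2 ∣ 1ℤ + f i) → + 2 ∣ + n + sum f
  sum-odd {zero} _ = divides 0ℤ refl
  sum-odd {suc n} {f} odd = subst (+ 2 ∣_) (regroup (f zero) (+ n) (sum (f ∘ suc)))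
                                  (∣m∣n⇒∣m+n (odd zero) (sum-odd (odd ∘ suc)))
    where
    regroup : ∀ a b c → (1ℤ + a) + (b + c) ≡ (1ℤ + b) + (a + c)
    regroup = solve-∀

  zeroCount-odd : ∀ k {x : Vector ℤ (suc (2 ℕ.* k))} → (∀ r → Trit (x r)) → sum x ≡ 0ℤ →
                  ¬ + 2 ∣ sum (zeroIndicator ∘ x)
  zeroCount-odd k {x} trit sum≡0 2∣Z = 2∤1 (∣m+n∣n⇒∣m 2∣1+2k+Z (∣m∣n⇒∣m+n 2∣2k 2∣Z))
    where
    2k : ℤ
    2k = + (2 ℕ.* k)
    Z : ℤ
    Z = sum (zeroIndicator ∘ x)
    2∣2k : + 2 ∣ 2k
    2∣2k = divides (+ k) (trans (pos-* 2 k) (*-comm (+ 2) (+ k)))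
    2∣1+2k+Z : + 2 ∣ 1ℤ + (2k + Z)
    2∣1+2k+Z = subst (+ 2 ∣_) regroup
                 (sum-odd {f = λ r → x r + zeroIndicator (x r)} (trit+zeroIndicator-odd ∘ trit))
      where
      regroup : 1ℤ + 2k + sum (λ r → x r + zeroIndicator (x r)) ≡ 1ℤ + (2k + Z)
      regroup = begin
        1ℤ + 2k + sum (λ r → x r + zeroIndicator (x r))   ≡⟨ cong (λ s → 1ℤ + 2k + s) (∑-distrib-+ x (zeroIndicator ∘ x)) ⟩
        1ℤ + 2k + (sum x + Z)                               ≡⟨ cong (λ s → 1ℤ + 2k + (s + Z)) sum≡0 ⟩
        1ℤ + 2k + (0ℤ + Z)                                  ≡⟨ cong (λ s → 1ℤ + 2k + s) (+-identityˡ Z) ⟩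
        1ℤ + 2k + Z                                         ≡⟨ +-assoc 1ℤ 2k Z ⟩
        1ℤ + (2k + Z)                                       ∎
        where open ≡-Reasoning

  ¬zero-free : ∀ k {x : Vector ℤ (suc (2 ℕ.* k))} → (∀ r → Trit (x r)) → sum x ≡ 0ℤ →
               ¬ (∀ r → x r ≢ 0ℤ)
  ¬zero-free k {x} trit sum≡0 nonzero =
    zeroCount-odd k trit sum≡0
      (divides 0ℤ (sum-zero {f = zeroIndicator ∘ x} (λ r → zeroIndicator-≢0 (trit r) (nonzero r))))

  ¬two-zeros : ∀ k {x : Vector ℤ (suc (2 ℕ.* k))} → (∀ r → Trit (x r)) → sum x ≡ 0ℤ →
               ∀ {p q} → p ≢ q → x p ≡ 0ℤ → x q ≡ 0ℤ → ¬ (∀ r → r ≢ p → r ≢ q → x r ≢ 0ℤ)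
  ¬two-zeros k {x} trit sum≡0 p≢q xp≡0 xq≡0 nonzero = zeroCount-odd k trit sum≡0 (divides 1ℤ zeros≡2)
    where
    zeros≡2 : sum (zeroIndicator ∘ x) ≡ 1ℤ * + 2
    zeros≡2 rewrite sum-pair p≢q (λ r r≢p r≢q → zeroIndicator-≢0 (trit r) (nonzero r r≢p r≢q)) | xp≡0 | xq≡0 = refl

  column : ∀ {n} → Matrix n → Fin n → Vector ℤ n
  column P j r = P r j

  column-orthogonal : ∀ {n} (P : Matrix n) → ColumnsOrthogonal P → ∀ {i j} → i ≢ j → column P i · column P j ≡ 0ℤ
  column-orthogonal P orth {i} {j} i≢j = trans (sym (Σ≡sum (λ r → P r i * P r j))) (orth i j i≢j)

  module _ {n} (P : Matrix (suc n)) (col0 : ∀ r → P r zero ≡ + 1) (orth : ColumnsOrthogonal P) where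

    column-sum≡0 : ∀ {c} → c ≢ zero → sum (column P c) ≡ 0ℤ
    column-sum≡0 {c} c≢0 = begin
      sum (column P c)                 ≡⟨ sum-cong-≗ (λ r → trans (cong (_* P r c) (col0 r)) (*-identityˡ (P r c))) ⟨
      column P zero · column P c       ≡⟨ column-orthogonal P orth (≢-sym c≢0) ⟩
      0ℤ                               ∎
      where open ≡-Reasoning

    lone-zero-row : (∀ r c → Trit (P r c)) → ∀ {c z} → c ≢ zero → P z c ≡ 0ℤ → (∀ r → r ≢ z → P r c ≢ 0ℤ) →
                    ∀ j → j ≢ zero → P z j ≡ 0ℤ
    lone-zero-row trit {c} {z} c≢0 Pzc≡0 nonzero j j≢0 with j ≟ᶠ c
    ... | yes refl = Pzc≡0
    ... | no j≢c = trit-even⇒0 (trit z j) (subst (+ 2 ∣_) gz≡Pzj 2∣gz)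
      where
      g : Vector ℤ (suc n)
      g r = P r j + P r c * P r j
      sum-g≡0 : sum g ≡ 0ℤ
      sum-g≡0 = trans (∑-distrib-+ (column P j) (λ r → P r c * P r j))
                      (cong₂ _+_ (column-sum≡0 j≢0) (column-orthogonal P orth (≢-sym j≢c)))
      2∣gz : + 2 ∣ g z
      2∣gz = ∣m+n∣n⇒∣m (subst (+ 2 ∣_) (sum-remove g) (divides 0ℤ sum-g≡0))
               (∣-sum (λ i → even-y+xy (P (punchIn z i) j) (trit _ c) (nonzero _ (punchInᵢ≢i z i))))
      gz≡Pzj : g z ≡ P z j
      gz≡Pzj = trans (cong (λ x → P z j + x * P z j) Pzc≡0) (+-identityʳ (P z j))

    ¬lone-zero : (∀ r c → Trit (P r c)) → (∀ c → P zero c ≡ + 1) →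
                 ∀ {c z} → c ≢ zero → P z c ≡ 0ℤ → ¬ (∀ r → r ≢ z → P r c ≢ 0ℤ)
    ¬lone-zero trit row0 {c} {z} c≢0 Pzc≡0 nonzero =
      let j , vj·vj≡0 = orthogonal-family-has-null n v v-orthogonal
      in  u·u≢0 (v j) (punchOut z≢0) (v-at-row0≢0 j) vj·vj≡0
      where
      z≢0 : z ≢ zero
      z≢0 refl with trans (sym (row0 c)) Pzc≡0
      ... | ()
      v : Fin (suc n) → Vector ℤ n
      v j = removeAt (column P j) z
      v-at-row0≢0 : ∀ j → v j (punchOut z≢0) ≢ 0ℤ
      v-at-row0≢0 j rewrite punchIn-punchOut z≢0 | row0 j = λ ()
      row-z-products : ∀ i j → i ≢ j → P z i * P z j ≡ 0ℤ
      row-z-products i j i≢j with i ≟ᶠ zero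
      ... | yes refl = trans (cong (P z zero *_) (lone-zero-row trit c≢0 Pzc≡0 nonzero j (≢-sym i≢j))) (*-zeroʳ (P z zero))
      ... | no i≢0 = cong (_* P z j) (lone-zero-row trit c≢0 Pzc≡0 nonzero i i≢0)
      v-orthogonal : ∀ i j → i ≢ j → v i · v j ≡ 0ℤ
      v-orthogonal i j i≢j = begin
        v i · v j                              ≡⟨ +-identityˡ (v i · v j) ⟨
        0ℤ + v i · v j                         ≡⟨ cong (_+ v i · v j) (row-z-products i j i≢j) ⟨
        P z i * P z j + v i · v j              ≡⟨ sum-remove (λ r → P r i * P r j) ⟨
        column P i · column P j                ≡⟨ column-orthogonal P orth i≢j ⟩
        0ℤ                                     ∎
        where open ≡-Reasoning

open import Data.Nat using (ℕ; suc; _*_)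
open import Data.Fin using (Fin)
open import Data.Integer using (ℤ; +_)
open import Data.Product using (_×_; ∃-syntax)
open import Relation.Binary.PropositionalEquality using (_≡_)
open import Relation.Nullary using (¬_)
open import Data.Fin using (zero)
open import Data.Fin.Properties using (any?) renaming (_≟_ to _≟ᶠ_)
open import Data.Integer.Properties using (_≟_)
open import Data.Product using (_,_)
open import Data.Empty using (⊥-elim)
open import Relation.Nullary using (yes; no; ¬?)
open import Relation.Nullary.Decidable using (_×-dec_)
open import Relation.Binary.PropositionalEquality using (refl; ≢-sym)

lemma2p5 : (k : ℕ) (P : Matrix (suc (2 * k))) →
    IsWeakHadamard P → IsNormalized P → ColumnsOrthogonal P →
    (c : Fin (suc (2 * k))) → ¬ (∀ (r : Fin (suc (2 * k))) → P r c ≡ + 1) →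
    ∃[ r₁ ] ∃[ r₂ ] ∃[ r₃ ]
      (¬ (r₁ ≡ r₂) × ¬ (r₁ ≡ r₃) × ¬ (r₂ ≡ r₃) ×
       P r₁ c ≡ + 0 × P r₂ c ≡ + 0 × P r₃ c ≡ + 0)
lemma2p5 k P (trit , _) (row0 , col0) orth c not-ones with c ≟ᶠ zero
... | yes refl = ⊥-elim (not-ones col0)
... | no c≢0 with any? (λ r → P r c ≟ + 0)
...   | no no-zero = ⊥-elim (¬zero-free k (λ r → trit r c) (column-sum≡0 P col0 orth c≢0)
                                   (λ r z → no-zero (r , z)))
...   | yes (z₁ , z₁-zero) with any? (λ r → ¬? (r ≟ᶠ z₁) ×-dec (P r c ≟ + 0))
...     | no one-zero = ⊥-elim (¬lone-zero P col0 orth trit row0 c≢0 z₁-zero (λ r r≢z₁ z → one-zero (r , r≢z₁ , z)))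
...     | yes (z₂ , z₂≢z₁ , z₂-zero) with any? (λ r → ¬? (r ≟ᶠ z₁) ×-dec ¬? (r ≟ᶠ z₂) ×-dec (P r c ≟ + 0))
...       | yes (z₃ , z₃≢z₁ , z₃≢z₂ , z₃-zero) =
  z₁ , z₂ , z₃ , ≢-sym z₂≢z₁ , ≢-sym z₃≢z₁ , ≢-sym z₃≢z₂ , z₁-zero , z₂-zero , z₃-zero
...       | no two-zeros = ⊥-elim (¬two-zeros k (λ r → trit r c) (column-sum≡0 P col0 orth c≢0)
                                    (≢-sym z₂≢z₁) z₁-zero z₂-zero (λ r r≢z₁ r≢z₂ z → two-zeros (r , r≢z₁ , r≢z₂ , z)))
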